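{- Let $G$ be a finite simple graph that is both $2K_2$-free and diamond-free, and let $\omega = \omega(G)$. Then $\chi(G) \leq \omega + 1$ if $\omega = 2$, and $\chi(G) \leq \omega$ if $\omega \geq 3$. Moreover, $G$ is perfect if $\omega \geq 4$.
   Context: A graph $G$ is $H$-free if $G$ contains no induced subgraph isomorphic to $H$. $2K_2$ is the disjoint union of two edges (four vertices, two disjoint edges, no other edges). The diamond is the graph obtained from $K_4$ by deleting one edge. $\chi(G)$ is the chromatic number and $\omega(G)$ the clique number of $G$. A graph is perfect if every induced subgraph $H$ satisfies $\chi(H) = \omega(H)$. -}

module Defs where

open import Data.Nat using (ℕ; _≤_)
open import Data.Fin using (Fin; zero; suc)
open import Data.Bool using (Bool; true; false)
open import Data.Product using (Σ; _×_; _,_)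
open import Relation.Nullary using (¬_)
open import Relation.Binary.PropositionalEquality using (_≡_; _≢_)
open import Function.Definitions using (Injective)

record Graph (n : ℕ) : Set where
  field
    adj   : Fin n → Fin n → Bool
    sym   : ∀ u v → adj u v ≡ adj v u
    irrefl : ∀ v → adj v v ≡ false
open Graph public

induced : ∀ {n k} (G : Graph n) (f : Fin k → Fin n) → Graph k
induced G f = record
  { adj = λ i j → adj G (f i) (f j)
  ; sym = λ i j → sym G (f i) (f j)
  ; irrefl = λ i → irrefl G (f i) }

InducedCopy : ∀ {k n} → Graph k → Graph n → Set
InducedCopy {k} {n} H G =
  Σ (Fin k → Fin n) λ f → Injective _≡_ _≡_ f × (∀ i j → adj H i j ≡ adj G (f i) (f j))

Free : ∀ {k n} → Graph k → Graph n → Set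
Free H G = ¬ InducedCopy H G

-- 2K₂ on vertices 0,1,2,3 with edges 01 and 23.
twoK2-adj : Fin 4 → Fin 4 → Bool
twoK2-adj zero (suc zero) = true
twoK2-adj (suc zero) zero = true
twoK2-adj (suc (suc zero)) (suc (suc (suc zero))) = true
twoK2-adj (suc (suc (suc zero))) (suc (suc zero)) = true
twoK2-adj _ _ = false

twoK2 : Graph 4
twoK2 = record
  { adj = twoK2-adj
  ; sym = λ { zero zero → refl' ; zero (suc zero) → refl' ; zero (suc (suc zero)) → refl' ; zero (suc (suc (suc zero))) → refl'
            ; (suc zero) zero → refl' ; (suc zero) (suc zero) → refl' ; (suc zero) (suc (suc zero)) → refl' ; (suc zero) (suc (suc (suc zero))) → refl'
            ; (suc (suc zero)) zero → refl' ; (suc (suc zero)) (suc zero) → refl' ; (suc (suc zero)) (suc (suc zero)) → refl' ; (suc (suc zero)) (suc (suc (suc zero))) → refl'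
            ; (suc (suc (suc zero))) zero → refl' ; (suc (suc (suc zero))) (suc zero) → refl' ; (suc (suc (suc zero))) (suc (suc zero)) → refl' ; (suc (suc (suc zero))) (suc (suc (suc zero))) → refl' }
  ; irrefl = λ { zero → refl' ; (suc zero) → refl' ; (suc (suc zero)) → refl' ; (suc (suc (suc zero))) → refl' } }
  where
  open import Relation.Binary.PropositionalEquality using () renaming (refl to refl')

-- Diamond = K₄ minus the edge {2,3}: all pairs of distinct vertices adjacent
-- except 2–3.
diamond-adj : Fin 4 → Fin 4 → Bool
diamond-adj zero zero = false
diamond-adj (suc zero) (suc zero) = false
diamond-adj (suc (suc zero)) (suc (suc zero)) = false
diamond-adj (suc (suc (suc zero))) (suc (suc (suc zero))) = false
diamond-adj (suc (suc zero)) (suc (suc (suc zero))) = false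
diamond-adj (suc (suc (suc zero))) (suc (suc zero)) = false
diamond-adj _ _ = true

diamond : Graph 4
diamond = record
  { adj = diamond-adj
  ; sym = λ { zero zero → refl' ; zero (suc zero) → refl' ; zero (suc (suc zero)) → refl' ; zero (suc (suc (suc zero))) → refl'
            ; (suc zero) zero → refl' ; (suc zero) (suc zero) → refl' ; (suc zero) (suc (suc zero)) → refl' ; (suc zero) (suc (suc (suc zero))) → refl'
            ; (suc (suc zero)) zero → refl' ; (suc (suc zero)) (suc zero) → refl' ; (suc (suc zero)) (suc (suc zero)) → refl' ; (suc (suc zero)) (suc (suc (suc zero))) → refl'
            ; (suc (suc (suc zero))) zero → refl' ; (suc (suc (suc zero))) (suc zero) → refl' ; (suc (suc (suc zero))) (suc (suc zero)) → refl' ; (suc (suc (suc zero))) (suc (suc (suc zero))) → refl' }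
  ; irrefl = λ { zero → refl' ; (suc zero) → refl' ; (suc (suc zero)) → refl' ; (suc (suc (suc zero))) → refl' } }
  where
  open import Relation.Binary.PropositionalEquality using () renaming (refl to refl')

HasClique : ∀ {n} → Graph n → ℕ → Set
HasClique {n} G k =
  Σ (Fin k → Fin n) λ f → Injective _≡_ _≡_ f × (∀ i j → i ≢ j → adj G (f i) (f j) ≡ true)

IsCliqueNumber : ∀ {n} → Graph n → ℕ → Set
IsCliqueNumber G w = HasClique G w × (∀ k → HasClique G k → k ≤ w)

Colorable : ∀ {n} → Graph n → ℕ → Set
Colorable {n} G c =
  Σ (Fin n → Fin c) λ col → ∀ u v → adj G u v ≡ true → col u ≢ col v

IsChromaticNumber : ∀ {n} → Graph n → ℕ → Set
IsChromaticNumber G c = Colorable G c × (∀ d → Colorable G d → c ≤ d)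

Perfect : ∀ {n} → Graph n → Set
Perfect {n} G =
  ∀ k (f : Fin k → Fin n) → Injective _≡_ _≡_ f →
  ∀ c w → IsChromaticNumber (induced G f) c → IsCliqueNumber (induced G f) w → c ≡ w

module Submission where

-- Fix a maximum clique Q = {Q 0, …, Q (ω-1)} of a (2K₂, diamond)-free graph G.
-- Diamond-freeness and maximality force every vertex outside Q to have at
-- most one neighbour in Q; 2K₂-freeness forbids an edge outside Q whose ends
-- both miss two vertices of Q.  So every outside vertex is either attached
-- to exactly one Q i or detached from Q, and:
--   * for ω ≥ 3 the vertices attached to the same Q i are independent, and
--     detached vertices are isolated from all other outside vertices;
--   * for ω ≥ 4 the vertices outside Q form an independent set.
-- Colouring Q i with colour i, the vertices attached to Q i with π i for a
-- fixed-point-free permutation π, and the detached vertices with one further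
-- colour (ω = 2) or an arbitrary old one (ω ≥ 3) gives χ ≤ ω + 1 resp.
-- χ ≤ ω.  For perfection (ω ≥ 4) an induced subgraph H with ω(H) ≥ 3 is
-- again (2K₂, diamond)-free, hence ω(H)-colourable; a triangle-free H meets Q
-- in at most two vertices and is 2-coloured around them, since its vertices
-- outside Q are independent.  Together with ω(H) ≤ χ(H) this gives χ = ω.

open import Defs
open import Data.Nat using (ℕ; zero; suc; _≤_; _+_; z≤n; s≤s)
open import Data.Nat.Properties using (≤-antisym; 1+n≰n; m≤n⇒m≤1+n)
open import Data.Fin using (Fin; zero; suc; inject₁; fromℕ; punchIn; punchOut; _<_)
open import Data.Fin.Properties
  using (_≟_; _<?_; any?; <-cmp; <⇒≢; <-trans; suc-injective; injective⇒≤;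
         inject₁-injective; fromℕ≢inject₁; punchIn-injective; punchInᵢ≢i; punchIn-punchOut)
open import Data.Vec using ([]; _∷_; lookup)
import Data.Vec.Functional as Vector
open import Data.Bool using (true; false)
open import Data.Bool.Properties using (¬-not) renaming (_≟_ to _≟ᵇ_)
open import Data.Product using (Σ; _×_; _,_)
open import Data.Empty using (⊥; ⊥-elim)
open import Relation.Nullary using (¬_; Dec; yes; no)
open import Relation.Nullary.Decidable using (_×-dec_)
open import Relation.Binary using (tri<; tri≈; tri>)
open import Relation.Binary.PropositionalEquality
  using (_≡_; _≢_; refl; trans; cong; cong₂) renaming (sym to ≡-sym)
open import Function.Definitions using (Injective)

pattern 0F = zero
pattern 1F = suc zero
pattern 2F = suc (suc zero)
pattern 3F = suc (suc (suc zero))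

true≢false : ∀ {b} → b ≡ true → b ≡ false → ⊥
true≢false refl ()

record PairAvoiding {m} (p q : Fin m) : Set where
  constructor avoiding
  field
    r s : Fin m
    r≢s : r ≢ s
    r≢p : r ≢ p
    r≢q : r ≢ q
    s≢p : s ≢ p
    s≢q : s ≢ q

-- With at least three indices, two of them avoid any given one:
-- take the first two indices of Fin m punched around p.
avoidingOne : ∀ {m} → 3 ≤ m → (p : Fin m) → PairAvoiding p p
avoidingOne (s≤s (s≤s (s≤s _))) p =
  avoiding (punchIn p 0F) (punchIn p 1F)
    (λ e → 0≢1 (punchIn-injective p 0F 1F e))
    (punchInᵢ≢i p 0F) (punchInᵢ≢i p 0F) (punchInᵢ≢i p 1F) (punchInᵢ≢i p 1F)
  where
  0≢1 : zero ≢ suc zero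
  0≢1 ()

-- With at least four indices, two of them avoid any given two: avoid
-- q' = punchOut p≢q in the smaller index set, then punch everything around p.
avoidingTwo : ∀ {m} → 4 ≤ m → (p q : Fin m) → PairAvoiding p q
avoidingTwo (s≤s 3≤m) p q with p ≟ q
... | yes refl = avoidingOne (m≤n⇒m≤1+n 3≤m) p
... | no p≢q =
  avoiding (punchIn p r) (punchIn p s)
    (λ e → r≢s (punchIn-injective p r s e))
    (punchInᵢ≢i p r) (avoidsQ r≢p) (punchInᵢ≢i p s) (avoidsQ s≢p)
  where
  open PairAvoiding (avoidingOne 3≤m (punchOut p≢q))
  avoidsQ : ∀ {t} → t ≢ punchOut p≢q → punchIn p t ≢ q
  avoidsQ t≢q' e = t≢q' (punchIn-injective p _ _ (trans e (≡-sym (punchIn-punchOut p≢q))))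

record Derangement (m : ℕ) : Set where
  field
    π : Fin m → Fin m
    injective : Injective _≡_ _≡_ π
    no-fixed-point : ∀ i → π i ≢ i

cyclicShift : ∀ m → Derangement (suc (suc m))
cyclicShift m = record { π = shift ; injective = shift-inj ; no-fixed-point = shift-moves }
  where
  shift : ∀ {k} → Fin (suc k) → Fin (suc k)
  shift {k} zero = fromℕ k
  shift (suc i) = inject₁ i
  shift-inj : ∀ {k} → Injective _≡_ _≡_ (shift {k})
  shift-inj {_} {zero} {zero} _ = refl
  shift-inj {_} {zero} {suc j} e = ⊥-elim (fromℕ≢inject₁ e)
  shift-inj {_} {suc i} {zero} e = ⊥-elim (fromℕ≢inject₁ (≡-sym e))
  shift-inj {_} {suc i} {suc j} e = cong suc (inject₁-injective e)
  inject₁≢suc : ∀ {k} (i : Fin k) → inject₁ i ≢ suc i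
  inject₁≢suc zero ()
  inject₁≢suc (suc i) e = inject₁≢suc i (suc-injective e)
  shift-moves : ∀ {k} (i : Fin (suc (suc k))) → shift i ≢ i
  shift-moves zero ()
  shift-moves (suc i) = inject₁≢suc i

module _ {n} (G : Graph n) where

  adjacent⇒distinct : ∀ {u v} → adj G u v ≡ true → u ≢ v
  adjacent⇒distinct {u} e refl = true≢false e (irrefl G u)

  flipped : ∀ {u v b} → adj G u v ≡ b → adj G v u ≡ b
  flipped {u} {v} e = trans (sym G v u) e

  cliqueFrom : ∀ {k} (f : Fin k → Fin n) →
    (∀ i j → i ≢ j → adj G (f i) (f j) ≡ true) → HasClique G k
  cliqueFrom f pairwise = f , injective , pairwise
    where
    injective : Injective _≡_ _≡_ f
    injective {i} {j} e with i ≟ j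
    ... | yes i≡j = i≡j
    ... | no i≢j = ⊥-elim (adjacent⇒distinct (pairwise i j i≢j) e)

  vertexClique : Fin n → HasClique G 1
  vertexClique u = cliqueFrom (λ _ → u) λ { 0F 0F 0≢0 → ⊥-elim (0≢0 refl) }

  edgeClique : ∀ {a b} → adj G a b ≡ true → HasClique G 2
  edgeClique {a} {b} ab = cliqueFrom ends pairwise
    where
    ends : Fin 2 → Fin n
    ends = lookup (a ∷ b ∷ [])
    pairwise : ∀ i j → i ≢ j → adj G (ends i) (ends j) ≡ true
    pairwise 0F 1F _ = ab
    pairwise 1F 0F _ = flipped ab
    pairwise 0F 0F ne = ⊥-elim (ne refl)
    pairwise 1F 1F ne = ⊥-elim (ne refl)

  triangle : ∀ {a b c} → adj G a b ≡ true → adj G a c ≡ true → adj G b c ≡ true →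
    HasClique G 3
  triangle {a} {b} {c} ab ac bc = cliqueFrom corners pairwise
    where
    corners : Fin 3 → Fin n
    corners = lookup (a ∷ b ∷ c ∷ [])
    pairwise : ∀ i j → i ≢ j → adj G (corners i) (corners j) ≡ true
    pairwise 0F 1F _ = ab
    pairwise 0F 2F _ = ac
    pairwise 1F 2F _ = bc
    pairwise 1F 0F _ = flipped ab
    pairwise 2F 0F _ = flipped ac
    pairwise 2F 1F _ = flipped bc
    pairwise 0F 0F ne = ⊥-elim (ne refl)
    pairwise 1F 1F ne = ⊥-elim (ne refl)
    pairwise 2F 2F ne = ⊥-elim (ne refl)

  inducedCopy4 : (K : Graph 4) (a b c d : Fin n) →
    a ≢ b → a ≢ c → a ≢ d → b ≢ c → b ≢ d → c ≢ d →
    adj K 0F 1F ≡ adj G a b → adj K 0F 2F ≡ adj G a c → adj K 0F 3F ≡ adj G a d →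
    adj K 1F 2F ≡ adj G b c → adj K 1F 3F ≡ adj G b d → adj K 2F 3F ≡ adj G c d →
    InducedCopy K G
  inducedCopy4 K a b c d ab ac ad bc bd cd e01 e02 e03 e12 e13 e23 = f , injective , agrees
    where
    f : Fin 4 → Fin n
    f = lookup (a ∷ b ∷ c ∷ d ∷ [])
    injective : Injective _≡_ _≡_ f
    injective {0F} {0F} _ = refl
    injective {1F} {1F} _ = refl
    injective {2F} {2F} _ = refl
    injective {3F} {3F} _ = refl
    injective {0F} {1F} e = ⊥-elim (ab e)
    injective {0F} {2F} e = ⊥-elim (ac e)
    injective {0F} {3F} e = ⊥-elim (ad e)
    injective {1F} {2F} e = ⊥-elim (bc e)
    injective {1F} {3F} e = ⊥-elim (bd e)
    injective {2F} {3F} e = ⊥-elim (cd e)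
    injective {1F} {0F} e = ⊥-elim (ab (≡-sym e))
    injective {2F} {0F} e = ⊥-elim (ac (≡-sym e))
    injective {3F} {0F} e = ⊥-elim (ad (≡-sym e))
    injective {2F} {1F} e = ⊥-elim (bc (≡-sym e))
    injective {3F} {1F} e = ⊥-elim (bd (≡-sym e))
    injective {3F} {2F} e = ⊥-elim (cd (≡-sym e))
    mirror : ∀ {i j x y} → adj K i j ≡ adj G x y → adj K j i ≡ adj G y x
    mirror {i} {j} {x} {y} e = trans (sym K j i) (trans e (sym G x y))
    diagonal : ∀ i x → adj K i i ≡ adj G x x
    diagonal i x = trans (irrefl K i) (≡-sym (irrefl G x))
    agrees : ∀ i j → adj K i j ≡ adj G (f i) (f j)
    agrees 0F 1F = e01
    agrees 0F 2F = e02
    agrees 0F 3F = e03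
    agrees 1F 2F = e12
    agrees 1F 3F = e13
    agrees 2F 3F = e23
    agrees 1F 0F = mirror e01
    agrees 2F 0F = mirror e02
    agrees 3F 0F = mirror e03
    agrees 2F 1F = mirror e12
    agrees 3F 1F = mirror e13
    agrees 3F 2F = mirror e23
    agrees 0F 0F = diagonal 0F a
    agrees 1F 1F = diagonal 1F b
    agrees 2F 2F = diagonal 2F c
    agrees 3F 3F = diagonal 3F d

  -- ω ≤ χ: a proper colouring is injective on every clique.
  clique≤colours : ∀ {w c} → HasClique G w → Colorable G c → w ≤ c
  clique≤colours (clique , _ , pairwise) (colour , proper) =
    injective⇒≤ {f = λ i → colour (clique i)} injective
    where
    injective : Injective _≡_ _≡_ (λ i → colour (clique i))
    injective {i} {j} e with i ≟ j
    ... | yes i≡j = i≡j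
    ... | no i≢j = ⊥-elim (proper (clique i) (clique j) (pairwise i j i≢j) e)

inducedFree : ∀ {m n k} (K : Graph m) (G : Graph n) (g : Fin k → Fin n) →
  Injective _≡_ _≡_ g → Free K G → Free K (induced G g)
inducedFree K G g g-inj K-free (copy , copy-inj , agrees) =
  K-free ((λ i → g (copy i)) , (λ e → copy-inj (g-inj e)) , agrees)

module AroundMaximumClique {n} (G : Graph n)
  (2K₂-free : Free twoK2 G) (diamond-free : Free diamond G)
  {ω : ℕ} (Q : Fin ω → Fin n)
  (Q-clique : ∀ i j → i ≢ j → adj G (Q i) (Q j) ≡ true)
  (Q-maximum : ∀ k → HasClique G k → k ≤ ω) where

  Outside : Fin n → Set
  Outside v = ∀ i → v ≢ Q i

  OnlyNeighbour : Fin n → Fin ω → Set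
  OnlyNeighbour v p = ∀ k → adj G v (Q k) ≡ true → k ≡ p

  Q-distinct : ∀ {i j} → i ≢ j → Q i ≢ Q j
  Q-distinct i≢j = adjacent⇒distinct G (Q-clique _ _ i≢j)

  -- Maximality: no vertex is adjacent to all of Q (it would extend Q).
  notJoinedToQ : ∀ v → ¬ (∀ i → adj G v (Q i) ≡ true)
  notJoinedToQ v joined = 1+n≰n (Q-maximum (suc ω) (cliqueFrom G (v Vector.∷ Q) pairwise))
    where
    pairwise : ∀ i j → i ≢ j → adj G ((v Vector.∷ Q) i) ((v Vector.∷ Q) j) ≡ true
    pairwise zero zero ne = ⊥-elim (ne refl)
    pairwise zero (suc j) _ = joined j
    pairwise (suc i) zero _ = flipped G (joined i)
    pairwise (suc i) (suc j) ne = Q-clique i j (λ e → ne (cong suc e))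

  -- Diamond-freeness: an outside vertex with two neighbours Q i, Q j
  -- misses some Q k, and Q i, Q j, Q k, v would induce a diamond.
  atMostOneNeighbour : ∀ {v} → Outside v → ∀ {i j} →
    adj G v (Q i) ≡ true → adj G v (Q j) ≡ true → i ≡ j
  atMostOneNeighbour {v} out {i} {j} vi vj with i ≟ j
  ... | yes i≡j = i≡j
  ... | no i≢j with any? (λ k → adj G v (Q k) ≟ᵇ false)
  ...   | no joined = ⊥-elim (notJoinedToQ v (λ k → ¬-not (λ vk → joined (k , vk))))
  ...   | yes (k , vk) = ⊥-elim (diamond-free (inducedCopy4 G diamond (Q i) (Q j) (Q k) v
          (Q-distinct i≢j) (Q-distinct (seen≢missed i vi vk)) (λ e → adjacent⇒distinct G vi (≡-sym e))
          (Q-distinct (seen≢missed j vj vk)) (λ e → adjacent⇒distinct G vj (≡-sym e)) (λ e → out k (≡-sym e))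
          (≡-sym (Q-clique i j i≢j)) (≡-sym (Q-clique i k (seen≢missed i vi vk)))
          (≡-sym (flipped G vi)) (≡-sym (Q-clique j k (seen≢missed j vj vk)))
          (≡-sym (flipped G vj)) (≡-sym (flipped G vk))))
    where
    seen≢missed : ∀ l {k} → adj G v (Q l) ≡ true → adj G v (Q k) ≡ false → l ≢ k
    seen≢missed l vl vk refl = true≢false vl vk

  edgeMeetsQ : ∀ {x y} → adj G x y ≡ true → Outside x → Outside y → ∀ {r s} → r ≢ s →
    adj G x (Q r) ≡ false → adj G x (Q s) ≡ false →
    adj G y (Q r) ≡ false → adj G y (Q s) ≡ false → ⊥
  edgeMeetsQ {x} {y} xy out-x out-y {r} {s} r≢s xr xs yr ys =
    2K₂-free (inducedCopy4 G twoK2 x y (Q r) (Q s)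
      (adjacent⇒distinct G xy) (out-x r) (out-x s) (out-y r) (out-y s) (Q-distinct r≢s)
      (≡-sym xy) (≡-sym xr) (≡-sym xs) (≡-sym yr) (≡-sym ys) (≡-sym (Q-clique r s r≢s)))

  edgeOutside : ∀ {x y p q} → adj G x y ≡ true → Outside x → Outside y →
    OnlyNeighbour x p → OnlyNeighbour y q → PairAvoiding p q → ⊥
  edgeOutside xy out-x out-y only-x only-y (avoiding r s r≢s r≢p r≢q s≢p s≢q) =
    edgeMeetsQ xy out-x out-y r≢s
      (misses only-x r≢p) (misses only-x s≢p) (misses only-y r≢q) (misses only-y s≢q)
    where
    misses : ∀ {v p t} → OnlyNeighbour v p → t ≢ p → adj G v (Q t) ≡ false
    misses only t≢p = ¬-not (λ vt → t≢p (only _ vt))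

  data Side (v : Fin n) : Set where
    onQ : ∀ i → v ≡ Q i → Side v
    offQ : Outside v → Side v

  side : ∀ v → Side v
  side v with any? (λ i → v ≟ Q i)
  ... | yes (i , v≡Qi) = onQ i v≡Qi
  ... | no not-on-Q = offQ (λ i e → not-on-Q (i , e))

  data Position (v : Fin n) : Set where
    member : ∀ i → v ≡ Q i → Position v
    attached : ∀ i → Outside v → adj G v (Q i) ≡ true → Position v
    detached : Outside v → (∀ i → adj G v (Q i) ≡ false) → Position v

  position : ∀ v → Position v
  position v with side v
  ... | onQ i v≡Qi = member i v≡Qi
  ... | offQ out with any? (λ i → adj G v (Q i) ≟ᵇ true)
  ...   | yes (i , vi) = attached i out vi
  ...   | no isolated = detached out (λ i → ¬-not (λ vi → isolated (i , vi)))

  -- Every outside vertex has (at most) one possible Q-neighbour; the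
  -- default index is used when it has none.
  onlyNeighbour : ∀ {v} → Outside v → Fin ω → Σ (Fin ω) (OnlyNeighbour v)
  onlyNeighbour {v} out default with position v
  ... | member i v≡Qi = ⊥-elim (out i v≡Qi)
  ... | attached i _ vi = i , λ k vk → atMostOneNeighbour out vk vi
  ... | detached _ misses = default , λ k vk → ⊥-elim (true≢false vk (misses k))

  attachedIndependent : 3 ≤ ω → ∀ {x y i} → Outside x → Outside y →
    adj G x (Q i) ≡ true → adj G y (Q i) ≡ true → adj G x y ≡ true → ⊥
  attachedIndependent h {i = i} out-x out-y xi yi xy =
    edgeOutside xy out-x out-y (λ k xk → atMostOneNeighbour out-x xk xi)
      (λ k yk → atMostOneNeighbour out-y yk yi) (avoidingOne h i)

  attachedDetachedNonadjacent : 3 ≤ ω → ∀ {x y i} → Outside x → Outside y →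
    adj G x (Q i) ≡ true → (∀ k → adj G y (Q k) ≡ false) → adj G x y ≡ true → ⊥
  attachedDetachedNonadjacent h {i = i} out-x out-y xi misses xy =
    edgeOutside xy out-x out-y (λ k xk → atMostOneNeighbour out-x xk xi)
      (λ k yk → ⊥-elim (true≢false yk (misses k))) (avoidingOne h i)

  detachedIndependent : 2 ≤ ω → ∀ {x y} → Outside x → Outside y →
    (∀ k → adj G x (Q k) ≡ false) → (∀ k → adj G y (Q k) ≡ false) → adj G x y ≡ true → ⊥
  detachedIndependent (s≤s (s≤s _)) out-x out-y x-misses y-misses xy =
    edgeMeetsQ xy out-x out-y {0F} {1F} (λ ())
      (x-misses 0F) (x-misses 1F) (y-misses 0F) (y-misses 1F)

  outsideIndependent : 4 ≤ ω → ∀ {x y} → Outside x → Outside y → adj G x y ≡ true → ⊥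
  outsideIndependent h@(s≤s _) out-x out-y xy
    with onlyNeighbour out-x zero | onlyNeighbour out-y zero
  ... | p , only-x | q , only-y = edgeOutside xy out-x out-y only-x only-y (avoidingTwo h p q)

  colourAroundQ : ∀ {c} (embed : Fin ω → Fin c) → Injective _≡_ _≡_ embed →
    (D : Derangement ω) (z : Fin c) →
    (∀ {x y i} → Outside x → Outside y →
       adj G x (Q i) ≡ true → adj G y (Q i) ≡ true → adj G x y ≡ true → ⊥) →
    (∀ {x y} → Outside x → Outside y →
       (∀ k → adj G x (Q k) ≡ false) → (∀ k → adj G y (Q k) ≡ false) → adj G x y ≡ true → ⊥) →
    (∀ {x y i} → Outside x → Outside y → adj G x (Q i) ≡ true →
       (∀ k → adj G y (Q k) ≡ false) → adj G x y ≡ true → embed (Derangement.π D i) ≢ z) →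
    Colorable G c
  colourAroundQ {c} embed embed-inj D z attached-indep detached-indep attached-detached =
    (λ v → colour (position v)) , λ u v uv → proper (position u) (position v) uv
    where
    open Derangement D
    colour : ∀ {v} → Position v → Fin c
    colour (member i _) = embed i
    colour (attached i _ _) = embed (π i)
    colour (detached _ _) = z
    memberVsOutside : ∀ i {v} (pv : Position v) → Outside v → adj G v (Q i) ≡ true →
      embed i ≢ colour pv
    memberVsOutside i (member j v≡Qj) out _ = ⊥-elim (out j v≡Qj)
    memberVsOutside i (attached j _ vj) out vi e =
      no-fixed-point j (trans (≡-sym (embed-inj e)) (atMostOneNeighbour out vi vj))
    memberVsOutside i (detached _ misses) out vi _ = true≢false vi (misses i)
    proper : ∀ {u v} (pu : Position u) (pv : Position v) → adj G u v ≡ true →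
      colour pu ≢ colour pv
    proper (member i refl) (member j refl) uv e = adjacent⇒distinct G uv (cong Q (embed-inj e))
    proper (member i refl) pv@(attached _ out _) uv = memberVsOutside i pv out (flipped G uv)
    proper (member i refl) pv@(detached out _) uv = memberVsOutside i pv out (flipped G uv)
    proper pu@(attached _ out _) (member i refl) uv e = memberVsOutside i pu out uv (≡-sym e)
    proper pu@(detached out _) (member i refl) uv e = memberVsOutside i pu out uv (≡-sym e)
    proper (attached i out-u ui) (attached j out-v vj) uv e with i ≟ j
    ... | yes refl = attached-indep out-u out-v ui vj uv
    ... | no i≢j = i≢j (injective (embed-inj e))
    proper (attached i out-u ui) (detached out-v misses) uv =
      attached-detached out-u out-v ui misses uv
    proper (detached out-u misses) (attached i out-v vi) uv e =
      attached-detached out-v out-u vi misses (flipped G uv) (≡-sym e)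
    proper (detached out-u u-misses) (detached out-v v-misses) uv =
      ⊥-elim (detached-indep out-u out-v u-misses v-misses uv)

  -- χ ≤ ω for ω ≥ 3: the detached vertices are isolated, so any colour does.
  colourableWithω : 3 ≤ ω → Colorable G ω
  colourableWithω h@(s≤s (s≤s (s≤s _))) =
    colourAroundQ (λ i → i) (λ e → e) (cyclicShift _) zero
      (attachedIndependent h) (detachedIndependent (s≤s (s≤s z≤n)))
      (λ out-x out-y xi misses xy → ⊥-elim (attachedDetachedNonadjacent h out-x out-y xi misses xy))

  -- χ ≤ 3 for ω = 2: attached classes are independent as there is no
  -- triangle, and the detached vertices get the third colour.
  colourableWith3 : ω ≡ 2 → Colorable G 3
  colourableWith3 refl =
    colourAroundQ inject₁ inject₁-injective (cyclicShift 0) (fromℕ 2)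
      (λ _ _ xi yi xy → noTriangle (Q-maximum 3 (triangle G xy xi yi)))
      (detachedIndependent (s≤s (s≤s z≤n)))
      (λ _ _ _ _ _ e → fromℕ≢inject₁ (≡-sym e))
    where
    noTriangle : ¬ (3 ≤ 2)
    noTriangle (s≤s (s≤s ()))

  -- For ω ≥ 4, a triangle-free induced subgraph H = G[g] is bipartite.
  -- It meets Q in at most two vertices; the first (by index) gets colour 0
  -- and the second colour 1, an H-vertex outside Q takes the colour opposite
  -- to its (unique) H-neighbour in Q, or 0 if it has none.
  module TriangleFree (ω≥4 : 4 ≤ ω) {k} (g : Fin k → Fin n)
    (triangle-free : ¬ HasClique (induced G g) 3) where

    open Derangement (cyclicShift 0) renaming (π to swap; no-fixed-point to swap-moves)

    EarlierMember : Fin ω → Set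
    EarlierMember i = Σ (Fin k) λ u → Σ (Fin ω) λ j → g u ≡ Q j × j < i

    earlier? : ∀ i → Dec (EarlierMember i)
    earlier? i = any? (λ u → any? (λ j → (g u ≟ Q j) ×-dec (j <? i)))

    rank : Fin ω → Fin 2
    rank i with earlier? i
    ... | yes _ = 1F
    ... | no _ = 0F

    -- Two H-vertices at Q i and Q j with i < j get ranks 0 and 1, since an
    -- earlier third one would close a triangle in H.
    ranksDiffer : ∀ {u₁ u₂ i j} → g u₁ ≡ Q i → g u₂ ≡ Q j → i < j → rank i ≢ rank j
    ranksDiffer {u₁} {u₂} {i} {j} u₁≡Qi u₂≡Qj i<j = differ
      where
      alongQ : ∀ {a b i j} → g a ≡ Q i → g b ≡ Q j → i ≢ j → adj G (g a) (g b) ≡ true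
      alongQ a≡Qi b≡Qj i≢j = trans (cong₂ (adj G) a≡Qi b≡Qj) (Q-clique _ _ i≢j)
      first : ¬ EarlierMember i
      first (u , l , u≡Ql , l<i) = triangle-free (triangle (induced G g)
        (alongQ u≡Ql u₁≡Qi (<⇒≢ l<i)) (alongQ u≡Ql u₂≡Qj (<⇒≢ (<-trans l<i i<j)))
        (alongQ u₁≡Qi u₂≡Qj (<⇒≢ i<j)))
      differ : rank i ≢ rank j
      differ with earlier? i | earlier? j
      ... | yes earlier | _ = ⊥-elim (first earlier)
      ... | no _ | no none = ⊥-elim (none (u₁ , i , u₁≡Qi , i<j))
      ... | no _ | yes _ = λ ()

    QNeighbour : Fin k → Set
    QNeighbour u = Σ (Fin k) λ u' → Σ (Fin ω) λ j → g u' ≡ Q j × adj G (g u) (g u') ≡ true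

    qNeighbour? : ∀ u → Dec (QNeighbour u)
    qNeighbour? u = any? (λ u' → any? (λ j → (g u' ≟ Q j) ×-dec (adj G (g u) (g u') ≟ᵇ true)))

    outsideColour : Fin k → Fin 2
    outsideColour u with qNeighbour? u
    ... | yes (_ , j , _) = swap (rank j)
    ... | no _ = 0F

    -- An outside H-vertex adjacent to the H-vertex at Q i is coloured
    -- opposite to rank i, its Q-neighbour being unique.
    oppositeToNeighbour : ∀ {u₁ u₂ i} → g u₁ ≡ Q i → Outside (g u₂) →
      adj G (g u₂) (g u₁) ≡ true → outsideColour u₂ ≡ swap (rank i)
    oppositeToNeighbour {u₁} {u₂} {i} u₁≡Qi out adjacent with qNeighbour? u₂
    ... | yes (u' , j , u'≡Qj , adjacent') = cong (λ l → swap (rank l))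
          (atMostOneNeighbour out (onNeighbour u'≡Qj adjacent') (onNeighbour u₁≡Qi adjacent))
      where
      onNeighbour : ∀ {a l} → g a ≡ Q l → adj G (g u₂) (g a) ≡ true → adj G (g u₂) (Q l) ≡ true
      onNeighbour a≡Ql e = trans (cong (adj G (g u₂)) (≡-sym a≡Ql)) e
    ... | no none = ⊥-elim (none (u₁ , i , u₁≡Qi , adjacent))

    colour : ∀ u → Side (g u) → Fin 2
    colour u (onQ i _) = rank i
    colour u (offQ _) = outsideColour u

    proper : ∀ u₁ u₂ (s₁ : Side (g u₁)) (s₂ : Side (g u₂)) →
      adj G (g u₁) (g u₂) ≡ true → colour u₁ s₁ ≢ colour u₂ s₂
    proper u₁ u₂ (onQ i u₁≡Qi) (onQ j u₂≡Qj) adjacent with <-cmp i j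
    ... | tri< i<j _ _ = ranksDiffer u₁≡Qi u₂≡Qj i<j
    ... | tri≈ _ refl _ = ⊥-elim (adjacent⇒distinct G adjacent (trans u₁≡Qi (≡-sym u₂≡Qj)))
    ... | tri> _ _ j<i = λ e → ranksDiffer u₂≡Qj u₁≡Qi j<i (≡-sym e)
    proper u₁ u₂ (onQ i u₁≡Qi) (offQ out) adjacent e =
      swap-moves (rank i) (trans (≡-sym (oppositeToNeighbour u₁≡Qi out (flipped G adjacent))) (≡-sym e))
    proper u₁ u₂ (offQ out) (onQ i u₂≡Qi) adjacent e =
      swap-moves (rank i) (trans (≡-sym (oppositeToNeighbour u₂≡Qi out adjacent)) e)
    proper u₁ u₂ (offQ out₁) (offQ out₂) adjacent =
      ⊥-elim (outsideIndependent ω≥4 out₁ out₂ adjacent)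

    bipartite : Colorable (induced G g) 2
    bipartite = (λ u → colour u (side (g u))) ,
      λ u₁ u₂ adjacent → proper u₁ u₂ (side (g u₁)) (side (g u₂)) adjacent

module _ {n} (G : Graph n) (2K₂-free : Free twoK2 G) (diamond-free : Free diamond G) where

  colourable3 : IsCliqueNumber G 2 → Colorable G 3
  colourable3 ((Q , _ , Q-clique) , Q-max) =
    AroundMaximumClique.colourableWith3 G 2K₂-free diamond-free Q Q-clique Q-max refl

  colourableω : ∀ {ω} → IsCliqueNumber G ω → 3 ≤ ω → Colorable G ω
  colourableω ((Q , _ , Q-clique) , Q-max) =
    AroundMaximumClique.colourableWithω G 2K₂-free diamond-free Q Q-clique Q-max

-- For ω(G) ≥ 4 every induced subgraph H = G[g] is ω(H)-colourable:
-- trivially for ω(H) ≤ 1, by bipartiteness for ω(H) = 2, and because H is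
-- again (2K₂, diamond)-free for ω(H) ≥ 3.
inducedColourable : ∀ {n ω} (G : Graph n) → Free twoK2 G → Free diamond G →
  IsCliqueNumber G ω → 4 ≤ ω → ∀ {k} (g : Fin k → Fin n) → Injective _≡_ _≡_ g →
  ∀ w → IsCliqueNumber (induced G g) w → Colorable (induced G g) w
inducedColourable G 2K₂-free diamond-free _ _ g _ 0 (_ , maximum) =
  (λ u → ⊥-elim (noVertex (maximum 1 (vertexClique (induced G g) u)))) ,
  (λ u → ⊥-elim (noVertex (maximum 1 (vertexClique (induced G g) u))))
  where
  noVertex : ¬ (1 ≤ 0)
  noVertex ()
inducedColourable G 2K₂-free diamond-free _ _ g _ 1 (_ , maximum) =
  (λ _ → zero) , λ u v uv _ → noEdge (maximum 2 (edgeClique (induced G g) uv))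
  where
  noEdge : ¬ (2 ≤ 1)
  noEdge (s≤s ())
inducedColourable G 2K₂-free diamond-free ((Q , _ , Q-clique) , Q-max) ω≥4 g _ 2 (_ , maximum) =
  AroundMaximumClique.TriangleFree.bipartite G 2K₂-free diamond-free Q Q-clique Q-max
    ω≥4 g (λ t → noTriangle (maximum 3 t))
  where
  noTriangle : ¬ (3 ≤ 2)
  noTriangle (s≤s (s≤s ()))
inducedColourable G 2K₂-free diamond-free _ _ g g-inj (suc (suc (suc _))) cn =
  colourableω (induced G g) (inducedFree twoK2 G g g-inj 2K₂-free)
    (inducedFree diamond G g g-inj diamond-free) cn (s≤s (s≤s (s≤s z≤n)))

perfect : ∀ {n ω} (G : Graph n) → Free twoK2 G → Free diamond G →
  IsCliqueNumber G ω → 4 ≤ ω → Perfect G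
perfect G 2K₂-free diamond-free cn ω≥4 _ g g-inj _ w (colourable , minimal) cnH@(clique , _) =
  ≤-antisym
    (minimal w (inducedColourable G 2K₂-free diamond-free cn ω≥4 g g-inj w cnH))
    (clique≤colours (induced G g) clique colourable)

theorem4 : ∀ (n : ℕ) (G : Graph n) (ω : ℕ) →
    Free twoK2 G → Free diamond G → IsCliqueNumber G ω →
    ((ω ≡ 2 → Colorable G (ω + 1)) × (3 ≤ ω → Colorable G ω)) × (4 ≤ ω → Perfect G)
theorem4 n G ω 2K₂-free diamond-free cn =
  ( (λ { refl → colourable3 G 2K₂-free diamond-free cn })
  , colourableω G 2K₂-free diamond-free cn )
  , perfect G 2K₂-free diamond-free cn
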